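{- Let $L$ be a finite modular lattice with exactly two coatoms and $U$ a finite modular lattice with exactly two atoms. Then every vertical 2-sum of $L$ and $U$ is a modular lattice.
   Context: With $\top_L$ the top of $L$, $\bot_U$ the bottom of $U$, $L'=L\setminus\{\top_L\}$ and $U'=U\setminus\{\bot_U\}$, a vertical 2-sum of $L$ and $U$ is the poset obtained from the disjoint union of $L'$ and $U'$ by identifying the two coatoms of $L$ with the two atoms of $U$ via some bijection, the order being the transitive closure of the union of the orders of $L'$ and $U'$. (Such a vertical 2-sum is always a lattice.) -}

module Defs where

open import Level using (0ℓ)
open import Data.Nat using (ℕ)
open import Data.Fin using (Fin)
open import Data.Sum using (_⊎_)
open import Data.Product using (Σ; _×_; ∃₂)
open import Data.Empty using (⊥)
open import Relation.Binary.Core using (Rel)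
open import Relation.Binary.PropositionalEquality using (_≡_; _≢_)
open import Algebra.Core using (Op₂)
open import Relation.Binary.Lattice.Structures using (IsLattice)

Modular : {A : Set} (_≈_ : Rel A 0ℓ) (_≤_ : Rel A 0ℓ) (_∨_ _∧_ : Op₂ A) → Set
Modular {A} _≈_ _≤_ _∨_ _∧_ =
  ∀ (x y z : A) → x ≤ z → (x ∨ (y ∧ z)) ≈ ((x ∨ y) ∧ z)

record FinModLattice : Set₁ where
  field
    size      : ℕ
    _≤_       : Rel (Fin size) 0ℓ
    _∨_       : Op₂ (Fin size)
    _∧_       : Op₂ (Fin size)
    isLattice : IsLattice _≡_ _≤_ _∨_ _∧_
    modular   : Modular _≡_ _≤_ _∨_ _∧_

module _ (L : FinModLattice) where
  open FinModLattice L

  _<_ : Rel (Fin size) 0ℓ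
  x < y = x ≤ y × x ≢ y

  IsTop : Fin size → Set
  IsTop t = ∀ x → x ≤ t

  IsBottom : Fin size → Set
  IsBottom b = ∀ x → b ≤ x

  IsCoatom : Fin size → Set
  IsCoatom c = Σ (Fin size) λ t → IsTop t × c < t × (∀ z → c < z → z < t → ⊥)

  IsAtom : Fin size → Set
  IsAtom a = Σ (Fin size) λ b → IsBottom b × b < a × (∀ z → b < z → z < a → ⊥)

  ExactlyTwoCoatoms : Fin size → Fin size → Set
  ExactlyTwoCoatoms c₁ c₂ =
    c₁ ≢ c₂ × IsCoatom c₁ × IsCoatom c₂ × (∀ c → IsCoatom c → c ≡ c₁ ⊎ c ≡ c₂)

  ExactlyTwoAtoms : Fin size → Fin size → Set
  ExactlyTwoAtoms a₁ a₂ =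
    a₁ ≢ a₂ × IsAtom a₁ × IsAtom a₂ × (∀ a → IsAtom a → a ≡ a₁ ⊎ a ≡ a₂)

-- The vertical 2-sum of L and U, with ⊤_L = tL, ⊥_U = bU, where the coatom
-- c₁ of L is identified with the atom a₁ of U and c₂ with a₂.
module VerticalTwoSum (L U : FinModLattice)
                      (tL : Fin (FinModLattice.size L))
                      (bU : Fin (FinModLattice.size U))
                      (c₁ c₂ : Fin (FinModLattice.size L))
                      (a₁ a₂ : Fin (FinModLattice.size U)) where
  private
    module L = FinModLattice L
    module U = FinModLattice U

  data Elt : Set where
    l : (x : Fin L.size) → x ≢ tL → Elt
    u : (y : Fin U.size) → y ≢ bU → Elt

  data _∼_ : Rel Elt 0ℓ where
    l≡    : ∀ {x x' p p'} → x ≡ x' → l x p ∼ l x' p'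
    u≡    : ∀ {y y' q q'} → y ≡ y' → u y q ∼ u y' q'
    glue₁ : ∀ {p q} → l c₁ p ∼ u a₁ q
    glue₂ : ∀ {p q} → l c₂ p ∼ u a₂ q
    ∼-sym   : ∀ {e f} → e ∼ f → f ∼ e
    ∼-trans : ∀ {e f g} → e ∼ f → f ∼ g → e ∼ g

  data _≼_ : Rel Elt 0ℓ where
    inL   : ∀ {x x' p p'} → x L.≤ x' → l x p ≼ l x' p'
    inU   : ∀ {y y' q q'} → y U.≤ y' → u y q ≼ u y' q'
    ident : ∀ {e f} → e ∼ f → e ≼ f
    ≼-trans : ∀ {e f g} → e ≼ f → f ≼ g → e ≼ g

  IsModularLattice : Set
  IsModularLattice =
    Σ (Op₂ Elt) λ _∨_ → Σ (Op₂ Elt) λ _∧_ →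
      IsLattice _∼_ _≼_ _∨_ _∧_ × Modular _∼_ _≼_ _∨_ _∧_

module Submission where

-- Turning U upside down, L and the dual of U are both finite modular
-- lattices with a top and exactly two coatoms (TwoCoatomLattice); by
-- finiteness every element other than the top lies under a coatom.  The
-- 2-sum is the poset glued from the two non-top parts along the coatoms
-- (Glued), with an explicit order.  Joins are computed explicitly: they are
-- taken in L or in U, except that two elements of L joining to the top of L
-- have the join a₁ ∨ a₂ of the atoms of U as join, and a mixed join raises
-- the U-element to the glue point above the L-element.  Meets are joins of
-- the gluing turned upside down (GluedLattice).  Modularity (GluedModular)
-- is a case analysis on the parts x, y, z lie in, each case reducing to the
-- modular law of L or of U, mostly in the form "x ≤ z and x ≰ c give
-- x ∨ (z ∧ c) = z" for a coatom c.

open import Defs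
open import Level using (0ℓ)
open import Algebra.Core using (Op₂)
open import Function.Base using (flip)
open import Data.Bool using (Bool; true; false; not; if_then_else_)
import Data.Bool as Bool
open import Data.Empty using (⊥-elim)
open import Data.Fin using (Fin; _≟_)
open import Data.List using (List; []; _∷_; allFin)
open import Data.List.Membership.Propositional using (_∈_)
open import Data.List.Membership.Propositional.Properties using (∈-allFin)
open import Data.List.Relation.Unary.Any using (here; there)
open import Data.Nat using (ℕ)
open import Data.Product using (Σ; _×_; _,_; proj₁; proj₂)
open import Data.Sum using (inj₁; inj₂)
open import Relation.Binary.Core using (Rel)
open import Relation.Binary.Definitions using (Decidable)
open import Relation.Binary.Lattice.Bundles using (Lattice)
open import Relation.Binary.Lattice.Structures using (IsLattice)
open import Relation.Binary.PropositionalEquality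
  using (_≡_; _≢_; refl; sym; trans; cong; subst; subst₂; ≢-sym; module ≡-Reasoning)
open import Relation.Nullary using (Dec; yes; no; ¬_)
open import Relation.Nullary.Decidable using (¬?; _×-dec_)

module LatticeFacts (L : FinModLattice) where
  open FinModLattice L public
  open IsLattice isLattice public
    using (x≤x∨y; y≤x∨y; ∨-least; x∧y≤x; x∧y≤y; ∧-greatest; antisym; reflexive)
    renaming (refl to ≤-refl; trans to ≤-trans)

  lattice : Lattice 0ℓ 0ℓ 0ℓ
  lattice = record { isLattice = isLattice }

  open import Relation.Binary.Lattice.Properties.Lattice lattice public
    using (∧-∨-isLattice)
  open import Relation.Binary.Lattice.Properties.JoinSemilattice
    (Lattice.joinSemilattice lattice) public
    using (∨-comm; ≈-dec⇒≤-dec)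
  open import Relation.Binary.Lattice.Properties.MeetSemilattice
    (Lattice.meetSemilattice lattice) public
    using (∧-comm; y≤x⇒x∧y≈y)

  _≤?_ : Decidable _≤_
  _≤?_ = ≈-dec⇒≤-dec _≟_

  modular-dual : ∀ x y z → z ≤ x → (x ∧ (y ∨ z)) ≡ ((x ∧ y) ∨ z)
  modular-dual x y z z≤x = begin
    x ∧ (y ∨ z)     ≡⟨ ∧-comm x (y ∨ z) ⟩
    (y ∨ z) ∧ x     ≡⟨ cong (_∧ x) (∨-comm y z) ⟩
    (z ∨ y) ∧ x     ≡⟨ sym (modular z y x z≤x) ⟩
    z ∨ (y ∧ x)     ≡⟨ cong (z ∨_) (∧-comm y x) ⟩
    z ∨ (x ∧ y)     ≡⟨ ∨-comm z (x ∧ y) ⟩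
    (x ∧ y) ∨ z     ∎
    where open ≡-Reasoning

dual : FinModLattice → FinModLattice
dual L = record
  { size      = size
  ; _≤_       = flip _≤_
  ; _∨_       = _∧_
  ; _∧_       = _∨_
  ; isLattice = ∧-∨-isLattice
  ; modular   = modular-dual
  }
  where open LatticeFacts L

module MaximalAbove {n : ℕ} (R : Rel (Fin n) 0ℓ) (R? : Decidable R)
                    (R-refl : ∀ {x} → R x x)
                    (R-trans : ∀ {x y z} → R x y → R y z → R x z)
                    (P : Fin n → Set) (P? : ∀ x → Dec (P x)) where

  scan : List (Fin n) → Fin n → Fin n
  scan [] m = m
  scan (w ∷ ws) m with P? w | R? m w
  ... | yes _ | yes _ = scan ws w
  ... | yes _ | no  _ = scan ws m
  ... | no  _ | _     = scan ws m

  ScanResult : List (Fin n) → Fin n → Set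
  ScanResult ws m = P (scan ws m) × R m (scan ws m) ×
                    (∀ w → w ∈ ws → P w → R (scan ws m) w → R w (scan ws m))

  scan-result : ∀ ws m → P m → ScanResult ws m
  scan-result [] m pm = pm , R-refl , λ _ ()
  scan-result (w ∷ ws) m pm with P? w | R? m w
  ... | yes pw | yes m≤w =
    let (pr , w≤r , maxr) = scan-result ws w pw in
    pr , R-trans m≤w w≤r ,
    λ { _ (here refl) _ _ → w≤r ; v (there v∈) pv r≤v → maxr v v∈ pv r≤v }
  ... | yes pw | no m≰w =
    let (pr , m≤r , maxr) = scan-result ws m pm in
    pr , m≤r ,
    λ { _ (here refl) _ r≤w → ⊥-elim (m≰w (R-trans m≤r r≤w))
      ; v (there v∈) pv r≤v → maxr v v∈ pv r≤v }
  ... | no ¬pw | _ =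
    let (pr , m≤r , maxr) = scan-result ws m pm in
    pr , m≤r ,
    λ { _ (here refl) pw _ → ⊥-elim (¬pw pw) ; v (there v∈) pv r≤v → maxr v v∈ pv r≤v }

  maximal-above : ∀ x → P x →
                  Σ (Fin n) λ m → P m × R x m × (∀ w → P w → R m w → R w m)
  maximal-above x px =
    let (pm , x≤m , maxm) = scan-result (allFin n) x px in
    scan (allFin n) x , pm , x≤m , λ w pw m≤w → maxm w (∈-allFin w) pw m≤w

record TwoCoatomLattice : Set₁ where
  field
    lat : FinModLattice
  open LatticeFacts lat public
  field
    t            : Fin size
    top          : ∀ x → x ≤ t
    c            : Bool → Fin size
    c-distinct   : c true ≢ c false
    c≢t          : ∀ i → c i ≢ t
    c-maximal    : ∀ i {z} → c i ≤ z → z ≢ t → z ≡ c i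
    below-coatom : ∀ x → x ≢ t → Σ Bool λ i → x ≤ c i

module CoatomsOf (L : FinModLattice) {t : Fin (FinModLattice.size L)} (top : IsTop L t) where
  open LatticeFacts L

  top-unique : ∀ {t'} → IsTop L t' → t ≡ t'
  top-unique top' = antisym (top' _) (top _)

  coatom≢top : ∀ {c} → IsCoatom L c → c ≢ t
  coatom≢top (_ , top' , (_ , c≢t') , _) c≡t = c≢t' (trans c≡t (top-unique top'))

  coatom-maximal : ∀ {c z} → IsCoatom L c → c ≤ z → z ≢ t → z ≡ c
  coatom-maximal {c} {z} (t' , top' , _ , nothing-between) c≤z z≢t with z ≟ c
  ... | yes z≡c = z≡c
  ... | no  z≢c = ⊥-elim (nothing-between z (c≤z , ≢-sym z≢c)
                           (top' z , λ z≡t' → z≢t (trans z≡t' (sym (top-unique top')))))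

  maximal-isCoatom : ∀ {m} → m ≢ t → (∀ {z} → m ≤ z → z ≢ t → z ≡ m) → IsCoatom L m
  maximal-isCoatom m≢t maximal =
    t , top , (top _ , m≢t) , λ z (m≤z , m≢z) (_ , z≢t) → m≢z (sym (maximal m≤z z≢t))

  below-maximal : ∀ x → x ≢ t →
                  Σ (Fin size) λ m → m ≢ t × x ≤ m × (∀ {z} → m ≤ z → z ≢ t → z ≡ m)
  below-maximal x x≢t =
    let (m , m≢t , x≤m , maxm) = maximal-above x x≢t in
    m , m≢t , x≤m , λ m≤z z≢t → antisym (maxm _ z≢t m≤z) m≤z
    where open MaximalAbove _≤_ _≤?_ ≤-refl ≤-trans (_≢ t) (λ x → ¬? (x ≟ t))

twoCoatomLattice : (L : FinModLattice) (t c₁ c₂ : Fin (FinModLattice.size L)) →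
                   IsTop L t → ExactlyTwoCoatoms L c₁ c₂ → TwoCoatomLattice
twoCoatomLattice L t c₁ c₂ top (c₁≢c₂ , coatom₁ , coatom₂ , only-two) = record
  { lat          = L
  ; t            = t
  ; top          = top
  ; c            = c
  ; c-distinct   = c₁≢c₂
  ; c≢t          = λ i → coatom≢top (isCoatom i)
  ; c-maximal    = λ i → coatom-maximal (isCoatom i)
  ; below-coatom = below-coatom
  }
  where
    open LatticeFacts L
    open CoatomsOf L top

    c : Bool → Fin size
    c i = if i then c₁ else c₂

    isCoatom : ∀ i → IsCoatom L (c i)
    isCoatom true  = coatom₁
    isCoatom false = coatom₂

    below-coatom : ∀ x → x ≢ t → Σ Bool λ i → x ≤ c i
    below-coatom x x≢t with below-maximal x x≢t
    ... | m , m≢t , x≤m , maxm with only-two m (maximal-isCoatom m≢t maxm)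
    ... | inj₁ refl = true  , x≤m
    ... | inj₂ refl = false , x≤m

module AtomsOf (U : FinModLattice) where

  atom⇒dual-coatom : ∀ {a} → IsAtom U a → IsCoatom (dual U) a
  atom⇒dual-coatom (b , bottom , (b≤a , b≢a) , nothing-between) =
    b , bottom , (b≤a , ≢-sym b≢a) ,
    λ z (z≤a , a≢z) (b≤z , z≢b) → nothing-between z (b≤z , ≢-sym z≢b) (z≤a , ≢-sym a≢z)

  dual-coatom⇒atom : ∀ {a} → IsCoatom (dual U) a → IsAtom U a
  dual-coatom⇒atom (b , bottom , (b≤a , a≢b) , nothing-between) =
    b , bottom , (b≤a , ≢-sym a≢b) ,
    λ z (b≤z , b≢z) (z≤a , z≢a) → nothing-between z (z≤a , ≢-sym z≢a) (b≤z , ≢-sym b≢z)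

  twoAtoms⇒dual-twoCoatoms : ∀ {a₁ a₂} → ExactlyTwoAtoms U a₁ a₂ →
                             ExactlyTwoCoatoms (dual U) a₁ a₂
  twoAtoms⇒dual-twoCoatoms (a₁≢a₂ , atom₁ , atom₂ , only-two) =
    a₁≢a₂ , atom⇒dual-coatom atom₁ , atom⇒dual-coatom atom₂ ,
    λ a coatom → only-two a (dual-coatom⇒atom coatom)

both-values : (Q : Bool → Set) → ∀ {i j} → i ≢ j → Q i → Q j → ∀ k → Q k
both-values Q {true}  {true}  i≢j _  _  _     = ⊥-elim (i≢j refl)
both-values Q {false} {false} i≢j _  _  _     = ⊥-elim (i≢j refl)
both-values Q {true}  {false} _   qi _  true  = qi
both-values Q {true}  {false} _   _  qj false = qj
both-values Q {false} {true}  _   _  qj true  = qj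
both-values Q {false} {true}  _   qi _  false = qi

not-≢ : ∀ i → i ≢ not i
not-≢ true  ()
not-≢ false ()

module TwoCoatomFacts (S : TwoCoatomLattice) where
  open TwoCoatomLattice S

  top-above : ∀ {x} → t ≤ x → x ≡ t
  top-above {x} t≤x = antisym (top x) t≤x

  ≢t-below : ∀ {x y} → x ≤ y → y ≢ t → x ≢ t
  ≢t-below x≤y y≢t refl = y≢t (top-above x≤y)

  ∧≢t : ∀ {y} y' → y ≢ t → y ∧ y' ≢ t
  ∧≢t {y} y' = ≢t-below (x∧y≤x y y')

  ∧c≢t : ∀ {y} i → y ∧ c i ≢ t
  ∧c≢t {y} i = ≢t-below (x∧y≤y y (c i)) (c≢t i)

  top-meet : ∀ z → t ∧ z ≡ z
  top-meet z = y≤x⇒x∧y≈y (top z)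

  meet-top : ∀ z → z ∧ t ≡ z
  meet-top z = trans (∧-comm z t) (top-meet z)

  coatom-injective : ∀ {i j} → c i ≤ c j → i ≡ j
  coatom-injective {true}  {true}  _ = refl
  coatom-injective {false} {false} _ = refl
  coatom-injective {true}  {false} ci≤cj =
    ⊥-elim (c-distinct (sym (c-maximal true ci≤cj (c≢t false))))
  coatom-injective {false} {true}  ci≤cj =
    ⊥-elim (c-distinct (c-maximal false ci≤cj (c≢t true)))

  join-coatom : ∀ {x} i → ¬ x ≤ c i → x ∨ c i ≡ t
  join-coatom {x} i x≰ci with (x ∨ c i) ≟ t
  ... | yes x∨ci≡t = x∨ci≡t
  ... | no  x∨ci≢t =
    ⊥-elim (x≰ci (subst (x ≤_) (c-maximal i (y≤x∨y x (c i)) x∨ci≢t) (x≤x∨y x (c i))))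

  coatoms-join : c true ∨ c false ≡ t
  coatoms-join = join-coatom false λ ct≤cf → not-≢ true (coatom-injective ct≤cf)

  c⊥ : Fin size
  c⊥ = c true ∧ c false

  c⊥≢t : c⊥ ≢ t
  c⊥≢t = ≢t-below (x∧y≤x _ _) (c≢t true)

  c⊥≤c : ∀ i → c⊥ ≤ c i
  c⊥≤c true  = x∧y≤x _ _
  c⊥≤c false = x∧y≤y _ _

  c⊥-sym : ∀ i → c i ∧ c (not i) ≡ c⊥
  c⊥-sym true  = refl
  c⊥-sym false = ∧-comm (c false) (c true)

  absorb-coatom-part : ∀ {x z} i → x ≤ z → ¬ x ≤ c i → x ∨ (z ∧ c i) ≡ z
  absorb-coatom-part {x} {z} i x≤z x≰ci = begin
    x ∨ (z ∧ c i)   ≡⟨ cong (x ∨_) (∧-comm z (c i)) ⟩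
    x ∨ (c i ∧ z)   ≡⟨ modular x (c i) z x≤z ⟩
    (x ∨ c i) ∧ z   ≡⟨ cong (_∧ z) (join-coatom i x≰ci) ⟩
    t ∧ z           ≡⟨ top-meet z ⟩
    z               ∎
    where open ≡-Reasoning

  absorb-c⊥ : ∀ {x} i → x ≤ c i → ¬ x ≤ c (not i) → x ∨ c⊥ ≡ c i
  absorb-c⊥ {x} i x≤ci x≰cj =
    trans (cong (x ∨_) (sym (c⊥-sym i))) (absorb-coatom-part (not i) x≤ci x≰cj)

-- The glued poset of SA and SB: the elements other than the top of SA
-- ("lower" elements l) and the elements other than the top of SB taken upside
-- down ("upper" elements u), the coatom c i of SA being glued to the coatom
-- c i of SB.  Each glue point occurs twice, as l (c i) and as u (c i); the two
-- copies lie below each other.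
module Glued (SA SB : TwoCoatomLattice) where
  module A = TwoCoatomLattice SA
  module B = TwoCoatomLattice SB
  module A′ = TwoCoatomFacts SA
  module B′ = TwoCoatomFacts SB

  data E : Set where
    l : (x : Fin A.size) → x ≢ A.t → E
    u : (y : Fin B.size) → y ≢ B.t → E

  infix 4 _⊑_
  data _⊑_ : E → E → Set where
    l⊑l : ∀ {x x' p p'} → x A.≤ x' → l x p ⊑ l x' p'
    u⊑u : ∀ {y y' q q'} → y' B.≤ y → u y q ⊑ u y' q'
    l⊑u : ∀ {x y p q} i → x A.≤ A.c i → y B.≤ B.c i → l x p ⊑ u y q
    u⊑l : ∀ {x y p q} i → B.c i B.≤ y → A.c i A.≤ x → u y q ⊑ l x p

  -- _⊑_ is a preorder (not antisymmetric: the two copies of a glue point)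
  ⊑-refl : ∀ {e} → e ⊑ e
  ⊑-refl {l x _} = l⊑l A.≤-refl
  ⊑-refl {u y _} = u⊑u B.≤-refl

  ⊑-trans : ∀ {e f g} → e ⊑ f → f ⊑ g → e ⊑ g
  ⊑-trans (l⊑l x≤x')   (l⊑l x'≤x'')  = l⊑l (A.≤-trans x≤x' x'≤x'')
  ⊑-trans (l⊑l x≤x')   (l⊑u i x'≤ y≤) = l⊑u i (A.≤-trans x≤x' x'≤) y≤
  ⊑-trans (l⊑u i x≤ y≤) (u⊑u y'≤y)    = l⊑u i x≤ (B.≤-trans y'≤y y≤)
  ⊑-trans (l⊑u {y = y} {q = q} i x≤ y≤) (u⊑l j cj≤y cj≤x')
    with B′.coatom-injective (subst (B._≤ B.c i) (B.c-maximal j cj≤y q) y≤)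
  ... | refl = l⊑l (A.≤-trans x≤ cj≤x')
  ⊑-trans (u⊑u y'≤y)   (u⊑u y''≤y')  = u⊑u (B.≤-trans y''≤y' y'≤y)
  ⊑-trans (u⊑u y'≤y)   (u⊑l i ci≤y' ci≤x) = u⊑l i (B.≤-trans ci≤y' y'≤y) ci≤x
  ⊑-trans (u⊑l i ci≤y ci≤x) (l⊑l x≤x') = u⊑l i ci≤y (A.≤-trans ci≤x x≤x')
  ⊑-trans (u⊑l i ci≤y ci≤x) (l⊑u j x≤cj y'≤cj)
    with A′.coatom-injective (A.≤-trans ci≤x x≤cj)
  ... | refl = u⊑u (B.≤-trans y'≤cj ci≤y)

  glue-u⊑l : ∀ i → u (B.c i) (B.c≢t i) ⊑ l (A.c i) (A.c≢t i)
  glue-u⊑l i = u⊑l i B.≤-refl A.≤-refl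

  glue-l⊑u : ∀ i → l (A.c i) (A.c≢t i) ⊑ u (B.c i) (B.c≢t i)
  glue-l⊑u i = l⊑u i A.≤-refl B.≤-refl

  infixr 5 _⟫_
  _⟫_ : ∀ {e f g} → e ⊑ f → f ⊑ g → e ⊑ g
  _⟫_ = ⊑-trans

  Linked : Fin A.size → Fin B.size → Set
  Linked x y = Σ Bool λ i → x A.≤ A.c i × y B.≤ B.c i

  linked? : ∀ x y → Dec (Linked x y)
  linked? x y with (x A.≤? A.c true) ×-dec (y B.≤? B.c true)
  ... | yes lt = yes (true , lt)
  ... | no ¬lt with (x A.≤? A.c false) ×-dec (y B.≤? B.c false)
  ... | yes lf = yes (false , lf)
  ... | no ¬lf = no λ { (true , lt) → ¬lt lt ; (false , lf) → ¬lf lf }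

  linked⇒⊑ : ∀ {x y p q} → Linked x y → l x p ⊑ u y q
  linked⇒⊑ (i , x≤ci , y≤ci) = l⊑u i x≤ci y≤ci

  linked-upper-under-both : ∀ {x y} → x ≢ A.t →
                            ∀ i → y B.≤ B.c i → y B.≤ B.c (not i) → Linked x y
  linked-upper-under-both {x} {y} p i y≤ci y≤cj =
    let (k , x≤ck) = A.below-coatom x p in
    k , x≤ck , both-values (λ k → y B.≤ B.c k) (not-≢ i) y≤ci y≤cj k

  linked-lower-under-both : ∀ {x y} → y ≢ B.t →
                            ∀ i → x A.≤ A.c i → x A.≤ A.c (not i) → Linked x y
  linked-lower-under-both {x} {y} q i x≤ci x≤cj =
    let (k , y≤ck) = B.below-coatom y q in
    k , both-values (λ k → x A.≤ A.c k) (not-≢ i) x≤ci x≤cj k , y≤ck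

  record IsJoin (p q w : E) : Set where
    constructor is-join
    field
      left  : p ⊑ w
      right : q ⊑ w
      least : ∀ {z} → p ⊑ z → q ⊑ z → w ⊑ z

  IsJoin-sym : ∀ {p q w} → IsJoin p q w → IsJoin q p w
  IsJoin-sym (is-join p⊑w q⊑w least) = is-join q⊑w p⊑w λ q⊑z p⊑z → least p⊑z q⊑z

  join-ll : ∀ {x x' p p'} (x∨x'≢t : x A.∨ x' ≢ A.t) →
            IsJoin (l x p) (l x' p') (l (x A.∨ x') x∨x'≢t)
  join-ll {x} {x'} {p} {p'} x∨x'≢t = is-join (l⊑l (A.x≤x∨y x x')) (l⊑l (A.y≤x∨y x x')) least
    where
      least : ∀ {z} → l x p ⊑ z → l x' p' ⊑ z → l (x A.∨ x') x∨x'≢t ⊑ z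
      least (l⊑l x≤v) (l⊑l x'≤v) = l⊑l (A.∨-least x≤v x'≤v)
      least (l⊑u i x≤ci v≤ci) (l⊑u j x'≤cj v≤cj) with i Bool.≟ j
      ... | yes refl = l⊑u i (A.∨-least x≤ci x'≤cj) v≤ci
      ... | no  i≢j  = let (k , x∨x'≤ck) = A.below-coatom (x A.∨ x') x∨x'≢t in
                       l⊑u k x∨x'≤ck (both-values (λ k → _ B.≤ B.c k) i≢j v≤ci v≤cj k)

  -- two lower elements joining to the top of SA: their join is the upper
  -- element c⊥ of SB, which lies above both glue points
  join-ll-top : ∀ {x x' p p'} → x A.∨ x' ≡ A.t →
                IsJoin (l x p) (l x' p') (u B′.c⊥ B′.c⊥≢t)
  join-ll-top {x} {x'} {p} {p'} x∨x'≡t = is-join (below-c⊥ p) (below-c⊥ p') least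
    where
      below-c⊥ : ∀ {x} (p : x ≢ A.t) → l x p ⊑ u B′.c⊥ B′.c⊥≢t
      below-c⊥ {x} p = let (k , x≤ck) = A.below-coatom x p in l⊑u k x≤ck (B′.c⊥≤c k)
      top≤ : ∀ {v} → x A.≤ v → x' A.≤ v → A.t A.≤ v
      top≤ x≤v x'≤v = subst (A._≤ _) x∨x'≡t (A.∨-least x≤v x'≤v)
      least : ∀ {z} → l x p ⊑ z → l x' p' ⊑ z → u B′.c⊥ B′.c⊥≢t ⊑ z
      least {l v v≢t} (l⊑l x≤v) (l⊑l x'≤v) =
        ⊥-elim (v≢t (A′.top-above (top≤ x≤v x'≤v)))
      least (l⊑u i x≤ci v≤ci) (l⊑u j x'≤cj v≤cj) with i Bool.≟ j
      ... | yes refl = ⊥-elim (A.c≢t i (A′.top-above (top≤ x≤ci x'≤cj)))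
      ... | no  i≢j  = u⊑u (B.∧-greatest (v≤ true) (v≤ false))
        where v≤ : ∀ k → _ B.≤ B.c k
              v≤ = both-values (λ k → _ B.≤ B.c k) i≢j v≤ci v≤cj

  join-uu : ∀ {y y' q q'} → IsJoin (u y q) (u y' q') (u (y B.∧ y') (B′.∧≢t y' q))
  join-uu {y} {y'} {q} {q'} = is-join (u⊑u (B.x∧y≤x y y')) (u⊑u (B.x∧y≤y y y')) least
    where
      least : ∀ {z} → u y q ⊑ z → u y' q' ⊑ z → u (y B.∧ y') (B′.∧≢t y' q) ⊑ z
      least (u⊑u v≤y) (u⊑u v≤y') = u⊑u (B.∧-greatest v≤y v≤y')
      least {l v v≢t} (u⊑l i ci≤y ci≤v) (u⊑l j cj≤y' cj≤v) with i Bool.≟ j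
      ... | yes refl = u⊑l i (B.∧-greatest ci≤y cj≤y') ci≤v
      ... | no  i≢j  = ⊥-elim (v≢t (A′.top-above
                         (subst (A._≤ v) A′.coatoms-join (A.∨-least (ci≤ true) (ci≤ false)))))
        where ci≤ : ∀ k → A.c k A.≤ v
              ci≤ = both-values (λ k → A.c k A.≤ v) i≢j ci≤v cj≤v

  join-linked : ∀ {x y p q} → Linked x y → IsJoin (l x p) (u y q) (u y q)
  join-linked (i , x≤ci , y≤ci) = is-join (l⊑u i x≤ci y≤ci) ⊑-refl λ _ y⊑z → y⊑z

  join-unlinked : ∀ {x y p q} i → ¬ Linked x y → x A.≤ A.c i →
                  IsJoin (l x p) (u y q) (u (y B.∧ B.c i) (B′.∧c≢t i))
  join-unlinked {x} {y} {p} {q} i unlinked x≤ci =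
    is-join (l⊑u i x≤ci (B.x∧y≤y y (B.c i))) (u⊑u (B.x∧y≤x y (B.c i))) least
    where
      least : ∀ {z} → l x p ⊑ z → u y q ⊑ z → u (y B.∧ B.c i) (B′.∧c≢t i) ⊑ z
      least {l v v≢t} (l⊑l x≤v) (u⊑l j cj≤y cj≤v) =
        ⊥-elim (unlinked (j , subst (x A.≤_) (A.c-maximal j cj≤v v≢t) x≤v ,
                              B.reflexive (B.c-maximal j cj≤y q)))
      least (l⊑u j x≤cj v≤cj) (u⊑u v≤y) with j Bool.≟ i
      ... | yes refl = u⊑u (B.∧-greatest v≤y v≤cj)
      ... | no  j≢i  = let (k , y≤ck) = B.below-coatom y q in
                       ⊥-elim (unlinked (k , both-values (λ k → x A.≤ A.c k) j≢i x≤cj x≤ci k ,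
                                             y≤ck))

  join-lu : (x : Fin A.size) (p : x ≢ A.t) (y : Fin B.size) (q : y ≢ B.t) → Dec (Linked x y) → E
  join-lu x p y q (yes _) = u y q
  join-lu x p y q (no  _) = u (y B.∧ B.c i) (B′.∧c≢t i)
    where i : Bool
          i = proj₁ (A.below-coatom x p)

  join-lu-isJoin : ∀ {x y} {p : x ≢ A.t} {q : y ≢ B.t} d →
                   IsJoin (l x p) (u y q) (join-lu x p y q d)
  join-lu-isJoin (yes linked)   = join-linked linked
  join-lu-isJoin {x} {p = p} (no  unlinked) =
    let (i , x≤ci) = A.below-coatom x p in join-unlinked i unlinked x≤ci

  join-ll-dec : (x : Fin A.size) (p : x ≢ A.t) (x' : Fin A.size) (p' : x' ≢ A.t) →
                Dec (x A.∨ x' ≡ A.t) → E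
  join-ll-dec x p x' p' (yes _)       = u B′.c⊥ B′.c⊥≢t
  join-ll-dec x p x' p' (no  x∨x'≢t) = l (x A.∨ x') x∨x'≢t

  join-ll-isJoin : ∀ {x x'} {p : x ≢ A.t} {p' : x' ≢ A.t} d →
                   IsJoin (l x p) (l x' p') (join-ll-dec x p x' p' d)
  join-ll-isJoin (yes x∨x'≡t) = join-ll-top x∨x'≡t
  join-ll-isJoin (no  x∨x'≢t) = join-ll x∨x'≢t

  join : E → E → E
  join (l x p) (l x' p') = join-ll-dec x p x' p' ((x A.∨ x') ≟ A.t)
  join (l x p) (u y q)   = join-lu x p y q (linked? x y)
  join (u y q) (l x p)   = join-lu x p y q (linked? x y)
  join (u y q) (u y' q') = u (y B.∧ y') (B′.∧≢t y' q)

  join-isJoin : ∀ p q → IsJoin p q (join p q)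
  join-isJoin (l x p) (l x' p') = join-ll-isJoin ((x A.∨ x') ≟ A.t)
  join-isJoin (l x p) (u y q)   = join-lu-isJoin (linked? x y)
  join-isJoin (u y q) (l x p)   = IsJoin-sym (join-lu-isJoin (linked? x y))
  join-isJoin (u y q) (u y' q') = join-uu

module _ {SA SB : TwoCoatomLattice} where
  private
    module G = Glued SA SB
    module D = Glued SB SA

  swap : G.E → D.E
  swap (G.l x p) = D.u x p
  swap (G.u y q) = D.l y q

  swap-antitone : ∀ {e f} → e G.⊑ f → swap f D.⊑ swap e
  swap-antitone (G.l⊑l x≤x')        = D.u⊑u x≤x'
  swap-antitone (G.u⊑u y'≤y)        = D.l⊑l y'≤y
  swap-antitone (G.l⊑u i x≤ci y≤ci) = D.l⊑u i y≤ci x≤ci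
  swap-antitone (G.u⊑l i ci≤y ci≤x) = D.u⊑l i ci≤x ci≤y

-- (a second module, as these facts use swap in both directions)
module _ {SA SB : TwoCoatomLattice} where
  private
    module G = Glued SA SB
    module D = Glued SB SA

  swap-involutive : ∀ e → swap {SB} {SA} (swap e) ≡ e
  swap-involutive (G.l x p) = refl
  swap-involutive (G.u y q) = refl

  swap-reflectˡ : ∀ {f w} → swap f D.⊑ w → swap w G.⊑ f
  swap-reflectˡ {f} {w} h = subst (swap w G.⊑_) (swap-involutive f) (swap-antitone h)

  swap-reflectʳ : ∀ {f w} → w D.⊑ swap f → f G.⊑ swap w
  swap-reflectʳ {f} {w} h = subst (G._⊑ swap w) (swap-involutive f) (swap-antitone h)

module GluedLattice (SA SB : TwoCoatomLattice) where
  open Glued SA SB public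
  private
    module D = Glued SB SA

  record IsMeet (p q w : E) : Set where
    constructor is-meet
    field
      left     : w ⊑ p
      right    : w ⊑ q
      greatest : ∀ {z} → z ⊑ p → z ⊑ q → z ⊑ w

  IsMeet-sym : ∀ {p q w} → IsMeet p q w → IsMeet q p w
  IsMeet-sym (is-meet w⊑p w⊑q greatest) = is-meet w⊑q w⊑p λ z⊑q z⊑p → greatest z⊑p z⊑q

  meet-from-dual-join : ∀ {p q w} → D.IsJoin (swap p) (swap q) w → IsMeet p q (swap w)
  meet-from-dual-join (D.is-join left right least) =
    is-meet (swap-reflectˡ left) (swap-reflectˡ right)
            λ z⊑p z⊑q → swap-reflectʳ (least (swap-antitone z⊑p) (swap-antitone z⊑q))

  meet : E → E → E
  meet p q = swap (D.join (swap p) (swap q))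

  meet-isMeet : ∀ p q → IsMeet p q (meet p q)
  meet-isMeet p q = meet-from-dual-join (D.join-isJoin (swap p) (swap q))

  meet-ll : ∀ {x x' p p'} → IsMeet (l x p) (l x' p') (l (x A.∧ x') (A′.∧≢t x' p))
  meet-ll = meet-from-dual-join D.join-uu

  meet-uu : ∀ {y y' q q'} (y∨y'≢t : y B.∨ y' ≢ B.t) →
            IsMeet (u y q) (u y' q') (u (y B.∨ y') y∨y'≢t)
  meet-uu y∨y'≢t = meet-from-dual-join (D.join-ll y∨y'≢t)

  meet-uu-top : ∀ {y y' q q'} → y B.∨ y' ≡ B.t →
                IsMeet (u y q) (u y' q') (l A′.c⊥ A′.c⊥≢t)
  meet-uu-top y∨y'≡t = meet-from-dual-join (D.join-ll-top y∨y'≡t)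

  meet-unlinked : ∀ {x y p q} i → ¬ Linked x y → y B.≤ B.c i →
                  IsMeet (l x p) (u y q) (l (x A.∧ A.c i) (A′.∧c≢t i))
  meet-unlinked i unlinked y≤ci =
    IsMeet-sym (meet-from-dual-join
      (D.join-unlinked i (λ { (k , y≤ck , x≤ck) → unlinked (k , x≤ck , y≤ck) }) y≤ci))

  join-upper₁ : ∀ p q → p ⊑ join p q
  join-upper₁ p q = IsJoin.left (join-isJoin p q)

  join-upper₂ : ∀ p q → q ⊑ join p q
  join-upper₂ p q = IsJoin.right (join-isJoin p q)

  join-least : ∀ {p q z} → p ⊑ z → q ⊑ z → join p q ⊑ z
  join-least {p} {q} = IsJoin.least (join-isJoin p q)

  meet-lower₁ : ∀ p q → meet p q ⊑ p
  meet-lower₁ p q = IsMeet.left (meet-isMeet p q)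

  meet-lower₂ : ∀ p q → meet p q ⊑ q
  meet-lower₂ p q = IsMeet.right (meet-isMeet p q)

  meet-greatest : ∀ {p q z} → z ⊑ p → z ⊑ q → z ⊑ meet p q
  meet-greatest {p} {q} = IsMeet.greatest (meet-isMeet p q)

  join-below : ∀ p q {w} → IsJoin p q w → join p q ⊑ w
  join-below p q (is-join left right _) = join-least left right

  join-above : ∀ p q {w} → IsJoin p q w → w ⊑ join p q
  join-above p q (is-join _ _ least) = least (join-upper₁ p q) (join-upper₂ p q)

  meet-below : ∀ p q {w} → IsMeet p q w → meet p q ⊑ w
  meet-below p q (is-meet _ _ greatest) = greatest (meet-lower₁ p q) (meet-lower₂ p q)

  meet-above : ∀ p q {w} → IsMeet p q w → w ⊑ meet p q
  meet-above p q (is-meet left right _) = meet-greatest left right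

  join-monoʳ : ∀ p {q q'} → q ⊑ q' → join p q ⊑ join p q'
  join-monoʳ p {q} {q'} q⊑q' = join-least (join-upper₁ p q') (q⊑q' ⟫ join-upper₂ p q')

  join-monoˡ : ∀ {p p'} q → p ⊑ p' → join p q ⊑ join p' q
  join-monoˡ {p} {p'} q p⊑p' = join-least (p⊑p' ⟫ join-upper₁ p' q) (join-upper₂ p' q)

  meet-monoˡ : ∀ {p p'} r → p ⊑ p' → meet p r ⊑ meet p' r
  meet-monoˡ {p} {p'} r p⊑p' = meet-greatest (meet-lower₁ p r ⟫ p⊑p') (meet-lower₂ p r)

-- For x ⊑ z only (x ∨ y) ∧ z ⊑ x ∨ (y ∧ z)
-- needs proof; it is checked according to the sides x, y, z lie on, using
-- the modular laws of SA and SB and the explicit joins and meets.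
module GluedModular (SA SB : TwoCoatomLattice) where
  open GluedLattice SA SB public

  -- equal coordinates give equivalent elements, whatever the proofs of ≢ t
  l-≡ : ∀ {x x' p p'} → x ≡ x' → l x p ⊑ l x' p'
  l-≡ refl = ⊑-refl

  u-≡ : ∀ {y y' q q'} → y ≡ y' → u y q ⊑ u y' q'
  u-≡ refl = ⊑-refl

  -- the two sides of the modular law; RHS ⊑ LHS holds in every lattice
  LHS RHS : E → E → E → E
  LHS p q r = meet (join p q) r
  RHS p q r = join p (meet q r)

  ModularAt : E → E → E → Set
  ModularAt p q r = LHS p q r ⊑ RHS p q r

  modular-if-p⊑q : ∀ {p q} r → p ⊑ q → ModularAt p q r
  modular-if-p⊑q {p} {q} r p⊑q =
    meet-monoˡ r (join-least p⊑q ⊑-refl) ⟫ join-upper₂ p (meet q r)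

  modular-if-q⊑p : ∀ {p q} r → q ⊑ p → ModularAt p q r
  modular-if-q⊑p {p} {q} r q⊑p =
    meet-lower₁ (join p q) r ⟫ join-least ⊑-refl q⊑p ⟫ join-upper₁ p (meet q r)

  modular-if-q⊑r : ∀ p {q r} → q ⊑ r → ModularAt p q r
  modular-if-q⊑r p {q} {r} q⊑r =
    meet-lower₁ (join p q) r ⟫ join-monoʳ p (meet-greatest ⊑-refl q⊑r)

  -- all three elements lower: the modular law of SA, where x ∨ y may
  -- have become an upper element
  modular-lll : ∀ {x y z px py pz} → x A.≤ z → ModularAt (l x px) (l y py) (l z pz)
  modular-lll {x} {y} {z} {px} {py} {pz} x≤z =
    lhs-bound ((x A.∨ y) ≟ A.t)
    ⟫ l-≡ (sym (A.modular x y z x≤z))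
    ⟫ join-above (l x px) y∧z (join-ll x∨[y∧z]≢t)
    ⟫ join-monoʳ (l x px) (meet-above (l y py) (l z pz) meet-ll)
    where
      y∧z : E
      y∧z = l (y A.∧ z) (A′.∧≢t z py)
      x∨[y∧z]≢t : x A.∨ (y A.∧ z) ≢ A.t
      x∨[y∧z]≢t = A′.≢t-below (A.∨-least x≤z (A.x∧y≤y y z)) pz
      lhs-bound : Dec (x A.∨ y ≡ A.t) →
                  LHS (l x px) (l y py) (l z pz) ⊑
                  l ((x A.∨ y) A.∧ z) (A′.≢t-below (A.x∧y≤y _ z) pz)
      lhs-bound (yes x∨y≡t) =
        meet-lower₂ (join (l x px) (l y py)) (l z pz)
        ⟫ l-≡ (sym (trans (cong (A._∧ z) x∨y≡t) (A′.top-meet z)))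
      lhs-bound (no  x∨y≢t) =
        meet-monoˡ (l z pz) (join-below (l x px) (l y py) (join-ll x∨y≢t))
        ⟫ meet-below (l (x A.∨ y) x∨y≢t) (l z pz) meet-ll ⟫ l-≡ refl

  modular-lul : ∀ {x y z px qy pz} → x A.≤ z → ModularAt (l x px) (u y qy) (l z pz)
  modular-lul {x} {y} {z} {px} {qy} {pz} x≤z = by-cases (linked? x y)
    where
      by-cases : Dec (Linked x y) → ModularAt (l x px) (u y qy) (l z pz)
      by-cases (yes x~y) = modular-if-p⊑q (l z pz) (linked⇒⊑ x~y)
      by-cases (no  x≁y) =
        meet-lower₂ (join (l x px) (u y qy)) (l z pz)
        ⟫ l-≡ (sym (A′.absorb-coatom-part i x≤z λ x≤ci → x≁y (i , x≤ci , y≤ci)))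
        ⟫ join-above (l x px) z∧ci (join-ll x∨[z∧ci]≢t)
        ⟫ join-monoʳ (l x px) (meet-above (u y qy) (l z pz) (IsMeet-sym (meet-unlinked i z≁y y≤ci)))
        where
          i : Bool
          i = proj₁ (B.below-coatom y qy)
          y≤ci : y B.≤ B.c i
          y≤ci = proj₂ (B.below-coatom y qy)
          z≁y : ¬ Linked z y
          z≁y (k , z≤ck , y≤ck) = x≁y (k , A.≤-trans x≤z z≤ck , y≤ck)
          z∧ci : E
          z∧ci = l (z A.∧ A.c i) (A′.∧c≢t i)
          x∨[z∧ci]≢t : x A.∨ (z A.∧ A.c i) ≢ A.t
          x∨[z∧ci]≢t = A′.≢t-below (A.∨-least x≤z (A.x∧y≤x z (A.c i))) pz

  modular-llu : ∀ {x y w px py qw} → l x px ⊑ u w qw → ModularAt (l x px) (l y py) (u w qw)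
  modular-llu {x} {y} {w} {px} {py} {qw} (l⊑u i x≤ci w≤ci) = by-cases (linked? y w)
    where
      by-cases : Dec (Linked y w) → ModularAt (l x px) (l y py) (u w qw)
      by-cases (yes y~w) = modular-if-q⊑r (l x px) (linked⇒⊑ y~w)
      by-cases (no  y≁w) =
        lhs-bound ((x A.∨ y) ≟ A.t)
        ⟫ l-≡ (sym (A.modular x y (A.c i) x≤ci))
        ⟫ join-above (l x px) y∧ci (join-ll x∨[y∧ci]≢t)
        ⟫ join-monoʳ (l x px) (meet-above (l y py) (u w qw) (meet-unlinked i y≁w w≤ci))
        where
          y∧ci : E
          y∧ci = l (y A.∧ A.c i) (A′.∧c≢t i)
          x∨[y∧ci]≢t : x A.∨ (y A.∧ A.c i) ≢ A.t
          x∨[y∧ci]≢t = A′.≢t-below (A.∨-least x≤ci (A.x∧y≤y y (A.c i))) (A.c≢t i)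
          -- w lies under the glue point i only, so c⊥ ∨ w = c i in SB
          c⊥∨w≡ci : B′.c⊥ B.∨ w ≡ B.c i
          c⊥∨w≡ci = trans (B.∨-comm B′.c⊥ w) (B′.absorb-c⊥ i w≤ci λ w≤cj →
                      y≁w (linked-upper-under-both py i w≤ci w≤cj))
          lhs-bound : Dec (x A.∨ y ≡ A.t) →
                      LHS (l x px) (l y py) (u w qw) ⊑ l ((x A.∨ y) A.∧ A.c i) (A′.∧c≢t i)
          lhs-bound (yes x∨y≡t) =
            meet-monoˡ (u w qw) (join-below (l x px) (l y py) (join-ll-top x∨y≡t))
            ⟫ meet-below (u B′.c⊥ B′.c⊥≢t) (u w qw)
                (meet-uu (subst (_≢ B.t) (sym c⊥∨w≡ci) (B.c≢t i)))
            ⟫ u-≡ c⊥∨w≡ci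
            ⟫ glue-u⊑l i
            ⟫ l-≡ (sym (trans (cong (A._∧ A.c i) x∨y≡t) (A′.top-meet (A.c i))))
          lhs-bound (no  x∨y≢t) =
            meet-monoˡ (u w qw) (join-below (l x px) (l y py) (join-ll x∨y≢t))
            ⟫ meet-below (l (x A.∨ y) x∨y≢t) (u w qw) (meet-unlinked i x∨y≁w w≤ci)
            where
              x∨y≁w : ¬ Linked (x A.∨ y) w
              x∨y≁w (k , x∨y≤ck , w≤ck) = y≁w (k , A.≤-trans (A.y≤x∨y x y) x∨y≤ck , w≤ck)

  modular-luu : ∀ {x y w px qy qw} → l x px ⊑ u w qw → ModularAt (l x px) (u y qy) (u w qw)
  modular-luu {x} {y} {w} {px} {qy} {qw} (l⊑u i x≤ci w≤ci) = by-cases (linked? x y)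
    where
      by-cases : Dec (Linked x y) → ModularAt (l x px) (u y qy) (u w qw)
      by-cases (yes x~y) = modular-if-p⊑q (u w qw) (linked⇒⊑ x~y)
      by-cases (no  x≁y) =
        meet-monoˡ (u w qw) (join-below (l x px) (u y qy) (join-unlinked i x≁y x≤ci))
        ⟫ meet-below y∧ci (u w qw) (meet-uu (subst (_≢ B.t) (sym [y∧ci]∨w≡) (B′.∧c≢t i)))
        ⟫ u-≡ [y∧ci]∨w≡
        ⟫ rhs-bound ((y B.∨ w) ≟ B.t)
        where
          y∧ci : E
          y∧ci = u (y B.∧ B.c i) (B′.∧c≢t i)
          [y∧ci]∨w≡ : (y B.∧ B.c i) B.∨ w ≡ (y B.∨ w) B.∧ B.c i
          [y∧ci]∨w≡ = begin
            (y B.∧ B.c i) B.∨ w   ≡⟨ B.∨-comm _ w ⟩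
            w B.∨ (y B.∧ B.c i)   ≡⟨ B.modular w y (B.c i) w≤ci ⟩
            (w B.∨ y) B.∧ B.c i   ≡⟨ cong (B._∧ B.c i) (B.∨-comm w y) ⟩
            (y B.∨ w) B.∧ B.c i   ∎
            where open ≡-Reasoning
          rhs-bound : Dec (y B.∨ w ≡ B.t) →
                      u ((y B.∨ w) B.∧ B.c i) (B′.∧c≢t i) ⊑ RHS (l x px) (u y qy) (u w qw)
          rhs-bound (no  y∨w≢t) =
            join-above (l x px) (u (y B.∨ w) y∨w≢t) (join-unlinked i x≁y∨w x≤ci)
            ⟫ join-monoʳ (l x px) (meet-above (u y qy) (u w qw) (meet-uu y∨w≢t))
            where
              x≁y∨w : ¬ Linked x (y B.∨ w)
              x≁y∨w (k , x≤ck , y∨w≤ck) = x≁y (k , x≤ck , B.≤-trans (B.x≤x∨y y w) y∨w≤ck)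
          -- here x lies under the glue point i only, so x ∨ c⊥ = c i in SA
          rhs-bound (yes y∨w≡t) =
            u-≡ (trans (cong (B._∧ B.c i) y∨w≡t) (B′.top-meet (B.c i)))
            ⟫ glue-u⊑l i
            ⟫ l-≡ (sym (A′.absorb-c⊥ i x≤ci λ x≤cj →
                         x≁y (linked-lower-under-both qy i x≤ci x≤cj)))
            ⟫ join-above (l x px) (l A′.c⊥ A′.c⊥≢t) (join-ll x∨c⊥≢t)
            ⟫ join-monoʳ (l x px) (meet-above (u y qy) (u w qw) (meet-uu-top y∨w≡t))
            where
              x∨c⊥≢t : x A.∨ A′.c⊥ ≢ A.t
              x∨c⊥≢t = A′.≢t-below (A.∨-least x≤ci (A′.c⊥≤c i)) (A.c≢t i)

  modular-ulu : ∀ {v y w qv py qw} → u v qv ⊑ u w qw → ModularAt (u v qv) (l y py) (u w qw)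
  modular-ulu {v} {y} {w} {qv} {py} {qw} (u⊑u w≤v) = by-cases (linked? y v) (w B.≤? B.c k)
    where
      k : Bool
      k = proj₁ (A.below-coatom y py)
      y≤ck : y A.≤ A.c k
      y≤ck = proj₂ (A.below-coatom y py)
      by-cases : Dec (Linked y v) → Dec (w B.≤ B.c k) → ModularAt (u v qv) (l y py) (u w qw)
      by-cases (yes y~v) _          = modular-if-q⊑p (u w qw) (linked⇒⊑ y~v)
      by-cases (no  _)   (yes w≤ck) = modular-if-q⊑r (u v qv) (linked⇒⊑ (k , y≤ck , w≤ck))
      by-cases (no  y≁v) (no  w≰ck) =
        meet-monoˡ (u w qw) (join-below (u v qv) (l y py) (IsJoin-sym (join-unlinked k y≁v y≤ck)))
        ⟫ meet-below (u (v B.∧ B.c k) (B′.∧c≢t k)) (u w qw)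
            (meet-uu (subst (_≢ B.t) (sym [v∧ck]∨w≡v) qv))
        ⟫ u-≡ [v∧ck]∨w≡v
        ⟫ join-upper₁ (u v qv) (meet (l y py) (u w qw))
        where
          [v∧ck]∨w≡v : (v B.∧ B.c k) B.∨ w ≡ v
          [v∧ck]∨w≡v = trans (B.∨-comm _ w) (B′.absorb-coatom-part k w≤v w≰ck)

  modular-uuu : ∀ {v y w qv qy qw} → u v qv ⊑ u w qw → ModularAt (u v qv) (u y qy) (u w qw)
  modular-uuu {v} {y} {w} {qv} {qy} {qw} (u⊑u w≤v) =
    meet-monoˡ (u w qw) (join-below (u v qv) (u y qy) join-uu)
    ⟫ meet-below (u (v B.∧ y) (B′.∧≢t y qv)) (u w qw) (meet-uu [v∧y]∨w≢t)
    ⟫ u-≡ (sym (B.modular-dual v y w w≤v))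
    ⟫ rhs-bound ((y B.∨ w) ≟ B.t)
    where
      [v∧y]∨w≢t : (v B.∧ y) B.∨ w ≢ B.t
      [v∧y]∨w≢t = B′.≢t-below (B.∨-least (B.x∧y≤x v y) w≤v) qv
      rhs-bound : Dec (y B.∨ w ≡ B.t) →
                  u (v B.∧ (y B.∨ w)) (B′.∧≢t _ qv) ⊑ RHS (u v qv) (u y qy) (u w qw)
      rhs-bound (yes y∨w≡t) =
        u-≡ (trans (cong (v B.∧_) y∨w≡t) (B′.meet-top v))
        ⟫ join-upper₁ (u v qv) (meet (u y qy) (u w qw))
      rhs-bound (no  y∨w≢t) =
        join-above (u v qv) (u (y B.∨ w) y∨w≢t) join-uu
        ⟫ join-monoʳ (u v qv) (meet-above (u y qy) (u w qw) (meet-uu y∨w≢t))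

  modular-lower : ∀ {x px} q r → l x px ⊑ r → ModularAt (l x px) q r
  modular-lower {px = px} (l y py) (l z pz) (l⊑l x≤z) = modular-lll {px = px} {py = py} {pz = pz} x≤z
  modular-lower {px = px} (u y qy) (l z pz) (l⊑l x≤z) = modular-lul {px = px} {qy = qy} {pz = pz} x≤z
  modular-lower (l y py) (u w qw) x⊑w       = modular-llu {py = py} x⊑w
  modular-lower (u y qy) (u w qw) x⊑w       = modular-luu {qy = qy} x⊑w

  -- the modular law: x ⊑ z gives (x ∨ y) ∧ z ⊑ x ∨ (y ∧ z).  When x is upper
  -- and z lower, x is a glue point, which may be replaced by its lower copy.
  modular : ∀ p q r → p ⊑ r → ModularAt p q r
  modular (l x px) q        r        x⊑z = modular-lower q r x⊑z
  modular (u v qv) (l y py) (u w qw) v⊑w = modular-ulu {py = py} v⊑w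
  modular (u v qv) (u y qy) (u w qw) v⊑w = modular-uuu {qy = qy} v⊑w
  modular (u v qv) q (l z pz) (u⊑l i ci≤v ci≤z) =
    meet-monoˡ (l z pz) (join-monoˡ q v⊑ci)
    ⟫ modular-lower q (l z pz) (l⊑l ci≤z)
    ⟫ join-monoˡ (meet q (l z pz)) ci⊑v
    where
      v⊑ci : u v qv ⊑ l (A.c i) (A.c≢t i)
      v⊑ci = u⊑l i ci≤v A.≤-refl
      ci⊑v : l (A.c i) (A.c≢t i) ⊑ u v qv
      ci⊑v = l⊑u i A.≤-refl (B.reflexive (B.c-maximal i ci≤v qv))

  modular-converse : ∀ p q r → p ⊑ r → RHS p q r ⊑ LHS p q r
  modular-converse p q r p⊑r =
    meet-greatest (join-least (join-upper₁ p q) (meet-lower₁ q r ⟫ join-upper₂ p q))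
                  (join-least p⊑r (meet-lower₂ q r))

-- The vertical 2-sum of Defs is the glued poset of L and the order dual of U,
-- presented by generators: its elements are those of the glued poset, its
-- identification and order relations are generated by the ones the glued
-- poset has.
module VerticalTwoSumIsGlued
  (L U : FinModLattice)
  (tL c₁ c₂ : Fin (FinModLattice.size L)) (bU a₁ a₂ : Fin (FinModLattice.size U))
  (topL : IsTop L tL) (twoCoatoms : ExactlyTwoCoatoms L c₁ c₂)
  (botU : IsBottom U bU) (twoAtoms : ExactlyTwoAtoms U a₁ a₂) where

  SA SB : TwoCoatomLattice
  SA = twoCoatomLattice L tL c₁ c₂ topL twoCoatoms
  SB = twoCoatomLattice (dual U) bU a₁ a₂ botU (AtomsOf.twoAtoms⇒dual-twoCoatoms U twoAtoms)

  open GluedModular SA SB using (E; l; u; _⊑_; l⊑l; u⊑u; l⊑u; u⊑l; ⊑-refl; ⊑-trans;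
    glue-l⊑u; glue-u⊑l; join; meet; join-upper₁; join-upper₂;
    join-least; meet-lower₁; meet-lower₂; meet-greatest; modular; modular-converse; LHS; RHS)
  open VerticalTwoSum L U tL bU c₁ c₂ a₁ a₂ renaming (l to lᵛ; u to uᵛ)
  private
    module A = TwoCoatomLattice SA
    module B = TwoCoatomLattice SB

  toE : Elt → E
  toE (lᵛ x p) = l x p
  toE (uᵛ y q) = u y q

  fromE : E → Elt
  fromE (l x p) = lᵛ x p
  fromE (u y q) = uᵛ y q

  from-to : ∀ e → fromE (toE e) ≡ e
  from-to (lᵛ x p) = refl
  from-to (uᵛ y q) = refl

  to-from : ∀ p → toE (fromE p) ≡ p
  to-from (l x p) = refl
  to-from (u y q) = refl

  glue : ∀ i {p q} → lᵛ (A.c i) p ∼ uᵛ (B.c i) q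
  glue true  = glue₁
  glue false = glue₂

  ∼-refl : ∀ {e} → e ∼ e
  ∼-refl {lᵛ x p} = l≡ refl
  ∼-refl {uᵛ y q} = u≡ refl

  ∼⇒⊑⊒ : ∀ {e f} → e ∼ f → (toE e ⊑ toE f) × (toE f ⊑ toE e)
  ∼⇒⊑⊒ (l≡ refl)         = ⊑-refl , ⊑-refl
  ∼⇒⊑⊒ (u≡ refl)         = ⊑-refl , ⊑-refl
  ∼⇒⊑⊒ glue₁             = glue-l⊑u true , glue-u⊑l true
  ∼⇒⊑⊒ glue₂             = glue-l⊑u false , glue-u⊑l false
  ∼⇒⊑⊒ (∼-sym e∼f)       = let (e⊑f , f⊑e) = ∼⇒⊑⊒ e∼f in f⊑e , e⊑f
  ∼⇒⊑⊒ (∼-trans e∼f f∼g) =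
    let (e⊑f , f⊑e) = ∼⇒⊑⊒ e∼f ; (f⊑g , g⊑f) = ∼⇒⊑⊒ f∼g in
    ⊑-trans e⊑f f⊑g , ⊑-trans g⊑f f⊑e

  ≼⇒⊑ : ∀ {e f} → e ≼ f → toE e ⊑ toE f
  ≼⇒⊑ (inL x≤x')        = l⊑l x≤x'
  ≼⇒⊑ (inU y≤y')        = u⊑u y≤y'
  ≼⇒⊑ (ident e∼f)       = proj₁ (∼⇒⊑⊒ e∼f)
  ≼⇒⊑ (≼-trans e≼f f≼g) = ⊑-trans (≼⇒⊑ e≼f) (≼⇒⊑ f≼g)

  -- and conversely: a comparison through a glue point is generated by the
  -- comparisons on each side and the identification of the glue point
  ⊑⇒≼ : ∀ p q → p ⊑ q → fromE p ≼ fromE q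
  ⊑⇒≼ (l x p) (l x' p') (l⊑l x≤x')        = inL x≤x'
  ⊑⇒≼ (u y q) (u y' q') (u⊑u y'≤y)        = inU y'≤y
  ⊑⇒≼ (l x p) (u y q)   (l⊑u i x≤ci y≤ci) =
    ≼-trans (inL {p' = A.c≢t i} x≤ci) (≼-trans (ident (glue i {q = B.c≢t i})) (inU y≤ci))
  ⊑⇒≼ (u y q) (l x p)   (u⊑l i ci≤y ci≤x) =
    ≼-trans (inU {q' = B.c≢t i} ci≤y)
            (≼-trans (ident (∼-sym (glue i {p = A.c≢t i}))) (inL ci≤x))

  above-glue : ∀ i {x y p q} → A.c i A.≤ x → B.c i B.≤ y → lᵛ x p ∼ uᵛ y q
  above-glue i {p = p} {q} ci≤x ci≤y =
    ∼-trans (l≡ (A.c-maximal i ci≤x p))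
            (∼-trans (glue i {A.c≢t i} {B.c≢t i}) (u≡ (sym (B.c-maximal i ci≤y q))))

  ⊑⊒⇒∼ : ∀ p q → p ⊑ q → q ⊑ p → fromE p ∼ fromE q
  ⊑⊒⇒∼ (l x p) (l x' p') (l⊑l x≤x') (l⊑l x'≤x) = l≡ (A.antisym x≤x' x'≤x)
  ⊑⊒⇒∼ (u y q) (u y' q') (u⊑u y'≤y) (u⊑u y≤y') = u≡ (B.antisym y≤y' y'≤y)
  ⊑⊒⇒∼ (l x p) (u y q)   _ (u⊑l i ci≤y ci≤x)   = above-glue i ci≤x ci≤y
  ⊑⊒⇒∼ (u y q) (l x p)   (u⊑l i ci≤y ci≤x) _   = ∼-sym (above-glue i ci≤x ci≤y)

  ≼-fromE : ∀ {e} p → toE e ⊑ p → e ≼ fromE p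
  ≼-fromE {e} p e⊑p = subst (_≼ fromE p) (from-to e) (⊑⇒≼ (toE e) p e⊑p)

  fromE-≼ : ∀ p {f} → p ⊑ toE f → fromE p ≼ f
  fromE-≼ p {f} p⊑f = subst (fromE p ≼_) (from-to f) (⊑⇒≼ p (toE f) p⊑f)

  _∨_ _∧_ : Op₂ Elt
  e ∨ f = fromE (join (toE e) (toE f))
  e ∧ f = fromE (meet (toE e) (toE f))

  isLattice : IsLattice _∼_ _≼_ _∨_ _∧_
  isLattice = record
    { isPartialOrder = record
      { isPreorder = record
        { isEquivalence = record { refl = ∼-refl ; sym = ∼-sym ; trans = ∼-trans }
        ; reflexive     = ident
        ; trans         = ≼-trans
        }
      ; antisym = λ {e} {f} e≼f f≼e → subst₂ _∼_ (from-to e) (from-to f)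
                    (⊑⊒⇒∼ (toE e) (toE f) (≼⇒⊑ e≼f) (≼⇒⊑ f≼e))
      }
    ; supremum = λ e f →
        ≼-fromE _ (join-upper₁ (toE e) (toE f)) , ≼-fromE _ (join-upper₂ (toE e) (toE f)) ,
        λ g e≼g f≼g → fromE-≼ _ (join-least (≼⇒⊑ e≼g) (≼⇒⊑ f≼g))
    ; infimum = λ e f →
        fromE-≼ _ (meet-lower₁ (toE e) (toE f)) , fromE-≼ _ (meet-lower₂ (toE e) (toE f)) ,
        λ g g≼e g≼f → ≼-fromE _ (meet-greatest (≼⇒⊑ g≼e) (≼⇒⊑ g≼f))
    }

  isModular : Modular _∼_ _≼_ _∨_ _∧_
  isModular e f g e≼g = subst₂ _∼_ (sym rhs) (sym lhs)
    (⊑⊒⇒∼ (RHS x y z) (LHS x y z) (modular-converse x y z x⊑z) (modular x y z x⊑z))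
    where
      x y z : E
      x = toE e ; y = toE f ; z = toE g
      x⊑z : x ⊑ z
      x⊑z = ≼⇒⊑ e≼g
      rhs : e ∨ (f ∧ g) ≡ fromE (RHS x y z)
      rhs = cong (λ m → fromE (join x m)) (to-from (meet y z))
      lhs : (e ∨ f) ∧ g ≡ fromE (LHS x y z)
      lhs = cong (λ j → fromE (meet j z)) (to-from (join x y))

lemma12 : (L U : FinModLattice)
          (tL : Fin (FinModLattice.size L)) (c₁ c₂ : Fin (FinModLattice.size L))
          (bU : Fin (FinModLattice.size U)) (a₁ a₂ : Fin (FinModLattice.size U)) →
          IsTop L tL → ExactlyTwoCoatoms L c₁ c₂ →
          IsBottom U bU → ExactlyTwoAtoms U a₁ a₂ →
          VerticalTwoSum.IsModularLattice L U tL bU c₁ c₂ a₁ a₂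
lemma12 L U tL c₁ c₂ bU a₁ a₂ topL twoCoatoms botU twoAtoms = _∨_ , _∧_ , isLattice , isModular
  where open VerticalTwoSumIsGlued L U tL c₁ c₂ bU a₁ a₂ topL twoCoatoms botU twoAtoms
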